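{- Let $s\geq 2$ and $k\geq 2$ be integers and let $n=2^s+k-1$. Then $$M^L(n)\leq 2^{2^s+k-s-1},$$ where $M^L(n)$ denotes the minimum cardinality of a local identifying code in the binary $n$-dimensional hypercube.
   Context: The binary $n$-dimensional hypercube is the graph with vertex set $\{0,1\}^n$ in which two binary words are adjacent iff their Hamming distance is $1$. For a vertex $u$, $N[u]$ is its closed neighbourhood, and for a code (nonempty vertex subset) $C$, $I_C(u)=N[u]\cap C$. A code $C$ is a covering code if $I_C(u)\neq\emptyset$ for every vertex $u$. A code $C$ is a local identifying code if it is a covering code and $I_C(u)\neq I_C(v)$ for every pair of adjacent vertices $u,v$. -}

module Defs where

open import Data.Nat using (ℕ; zero; suc; _+_)
open import Data.Bool using (Bool; true; false)
open import Data.Vec using (Vec; []; _∷_)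
open import Data.List using (List)
open import Data.List.Membership.Propositional using (_∈_)
open import Data.Product using (_×_; ∃)
open import Data.Sum using (_⊎_)
open import Relation.Binary.PropositionalEquality using (_≡_)
open import Relation.Nullary using (¬_)
open import Function.Bundles using (_⇔_)

Word : ℕ → Set
Word n = Vec Bool n

hamming : ∀ {n} → Word n → Word n → ℕ
hamming [] [] = 0
hamming (true ∷ u) (true ∷ v) = hamming u v
hamming (false ∷ u) (false ∷ v) = hamming u v
hamming (true ∷ u) (false ∷ v) = suc (hamming u v)
hamming (false ∷ u) (true ∷ v) = suc (hamming u v)

Adjacent : ∀ {n} → Word n → Word n → Set
Adjacent u v = hamming u v ≡ 1

InN[_] : ∀ {n} → Word n → Word n → Set
InN[ u ] v = (v ≡ u) ⊎ Adjacent u v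

-- a code is represented by a duplicate-free list; its cardinality is its length.
-- c ∈ I_C(u)  iff  c ∈ C and c ∈ N[u].
InI : ∀ {n} → List (Word n) → Word n → Word n → Set
InI C u c = (c ∈ C) × InN[ u ] c

SameI : ∀ {n} → List (Word n) → Word n → Word n → Set
SameI {n} C u v = (c : Word n) → InI C u c ⇔ InI C v c

IsCovering : ∀ {n} → List (Word n) → Set
IsCovering {n} C = (u : Word n) → ∃ λ c → InI C u c

IsLocalIdentifying : ∀ {n} → List (Word n) → Set
IsLocalIdentifying {n} C =
  IsCovering C × ((u v : Word n) → Adjacent u v → ¬ SameI C u v)

{-# OPTIONS --safe #-}

-- Take the binary linear code C whose parity-check matrix H = [R | I_s] has as columns every word
-- of length s, the zero word occurring k times; C has length 2^s + k - 1 and dimension 2^s + k - s - 1.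
-- If the syndrome of u is the column q, then u + e_q is a codeword, so C covers. Two distinct
-- neighbours u + e_p, u + e_q are at distance 2, hence a codeword u + e_q with q ≠ p separates u from
-- u + e_p. The only failure is when the syndrome of u is column p itself; then u + e_p is a codeword,
-- and a zero column q ≠ p (there are two) gives the codeword u + e_p + e_q separating in the other
-- direction.

module Submission where

open import Defs
open import Data.Nat using (ℕ; zero; suc; _+_; _∸_; _^_; _≤_; s≤s)
open import Data.Nat.Properties using (suc-injective; m+n∸m≡n; ≤-reflexive; +-identityʳ)
open import Data.Nat.Tactic.RingSolver using (solve-∀)
open import Data.Bool using (true; false; not; _xor_; if_then_else_)
open import Data.Bool.Properties using (xor-comm; xor-assoc; xor-identityˡ; xor-same)
open import Data.Fin as Fin using (Fin; zero; suc)
open import Data.Vec as V using (Vec; []; _∷_; lookup)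
open import Data.Vec.Properties using (∷-injectiveʳ; ++-injectiveˡ)
open import Data.Vec.Relation.Binary.Pointwise.Inductive
  using (Pointwise-≡⇒≡; zipWith-comm; zipWith-assoc; zipWith-identityˡ)
import Data.Vec.Membership.Propositional as VecMem
import Data.Vec.Membership.Propositional.Properties as VecMem
open import Data.Vec.Relation.Unary.Any as VecAny using (here; there)
open import Data.Vec.Relation.Unary.Any.Properties using (lookup-index)
open import Data.List as List using (List; length; [_]; map; _++_)
open import Data.List.Properties using (length-map; length-++)
open import Data.List.Membership.Propositional using (_∈_)
open import Data.List.Membership.Propositional.Properties using (∈-map⁺; ∈-map⁻; ∈-++⁺ˡ; ∈-++⁺ʳ)
open import Data.List.Relation.Unary.Any using (here)
open import Data.List.Relation.Unary.Unique.Propositional using (Unique)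
import Data.List.Relation.Unary.Unique.Propositional.Properties as Unique
import Data.List.Relation.Unary.AllPairs as AllPairs
import Data.List.Relation.Unary.All as All
open import Data.Product using (Σ; ∃; _×_; _,_; proj₁; proj₂)
open import Data.Sum using (_⊎_; inj₁; inj₂)
open import Relation.Nullary using (¬_; yes; no; contradiction)
open import Function using (_∘_; case_of_)
open import Relation.Binary.PropositionalEquality hiding ([_])
open import Function.Bundles using (Equivalence)
import Function.Properties.Equivalence as ⇔

zeros : ∀ n → Word n
zeros n = V.replicate n false

infixl 6 _⊕_
_⊕_ : ∀ {n} → Word n → Word n → Word n
_⊕_ = V.zipWith _xor_

⊕-comm : ∀ {n} (x y : Word n) → x ⊕ y ≡ y ⊕ x
⊕-comm x y = Pointwise-≡⇒≡ (zipWith-comm xor-comm x y)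

⊕-assoc : ∀ {n} (x y z : Word n) → (x ⊕ y) ⊕ z ≡ x ⊕ (y ⊕ z)
⊕-assoc x y z = Pointwise-≡⇒≡ (zipWith-assoc xor-assoc x y z)

⊕-identityˡ : ∀ {n} (x : Word n) → zeros n ⊕ x ≡ x
⊕-identityˡ x = Pointwise-≡⇒≡ (zipWith-identityˡ xor-identityˡ x)

⊕-self : ∀ {n} (x : Word n) → x ⊕ x ≡ zeros n
⊕-self []      = refl
⊕-self (b ∷ x) = cong₂ _∷_ (xor-same b) (⊕-self x)

⊕-cancelʳ : ∀ {n} (x y : Word n) → (x ⊕ y) ⊕ y ≡ x
⊕-cancelʳ {n} x y = begin
  (x ⊕ y) ⊕ y  ≡⟨ ⊕-assoc x y y ⟩
  x ⊕ (y ⊕ y)  ≡⟨ cong (x ⊕_) (⊕-self y) ⟩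
  x ⊕ zeros n  ≡⟨ ⊕-comm x (zeros n) ⟩
  zeros n ⊕ x  ≡⟨ ⊕-identityˡ x ⟩
  x            ∎
  where open ≡-Reasoning

⊕≡zeros⇒≡ : ∀ {n} (x y : Word n) → x ⊕ y ≡ zeros n → x ≡ y
⊕≡zeros⇒≡ {n} x y x⊕y≡0 = begin
  x            ≡⟨ ⊕-cancelʳ x y ⟨
  (x ⊕ y) ⊕ y  ≡⟨ cong (_⊕ y) x⊕y≡0 ⟩
  zeros n ⊕ y  ≡⟨ ⊕-identityˡ y ⟩
  y            ∎
  where open ≡-Reasoning

flipAt : ∀ {n} → Fin n → Word n → Word n
flipAt zero    (b ∷ u) = not b ∷ u
flipAt (suc p) (b ∷ u) = b ∷ flipAt p u

flipAt-involutive : ∀ {n} (p : Fin n) u → flipAt p (flipAt p u) ≡ u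
flipAt-involutive zero    (true ∷ u)  = refl
flipAt-involutive zero    (false ∷ u) = refl
flipAt-involutive (suc p) (b ∷ u)     = cong (b ∷_) (flipAt-involutive p u)

flipAt-injective : ∀ {n} (p q : Fin n) u → flipAt p u ≡ flipAt q u → p ≡ q
flipAt-injective zero    zero    u       _  = refl
flipAt-injective (suc p) (suc q) (b ∷ u) eq = cong suc (flipAt-injective p q u (∷-injectiveʳ eq))
flipAt-injective zero    (suc q) (true ∷ u)  ()
flipAt-injective zero    (suc q) (false ∷ u) ()
flipAt-injective (suc p) zero    (true ∷ u)  ()
flipAt-injective (suc p) zero    (false ∷ u) ()

hamming-∷ : ∀ {n} b (u v : Word n) → hamming (b ∷ u) (b ∷ v) ≡ hamming u v
hamming-∷ true  u v = refl
hamming-∷ false u v = refl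

hamming-not∷ : ∀ {n} b (u v : Word n) → hamming (not b ∷ u) (b ∷ v) ≡ suc (hamming u v)
hamming-not∷ true  u v = refl
hamming-not∷ false u v = refl

hamming-comm : ∀ {n} (u v : Word n) → hamming u v ≡ hamming v u
hamming-comm []          []          = refl
hamming-comm (true ∷ u)  (true ∷ v)  = hamming-comm u v
hamming-comm (true ∷ u)  (false ∷ v) = cong suc (hamming-comm u v)
hamming-comm (false ∷ u) (true ∷ v)  = cong suc (hamming-comm u v)
hamming-comm (false ∷ u) (false ∷ v) = hamming-comm u v

hamming-refl : ∀ {n} (u : Word n) → hamming u u ≡ 0
hamming-refl []      = refl
hamming-refl (b ∷ u) = trans (hamming-∷ b u u) (hamming-refl u)

hamming≡0⇒≡ : ∀ {n} (u v : Word n) → hamming u v ≡ 0 → u ≡ v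
hamming≡0⇒≡ []          []          _ = refl
hamming≡0⇒≡ (true ∷ u)  (true ∷ v)  d = cong (true ∷_) (hamming≡0⇒≡ u v d)
hamming≡0⇒≡ (false ∷ u) (false ∷ v) d = cong (false ∷_) (hamming≡0⇒≡ u v d)

hamming-flipAt : ∀ {n} (p : Fin n) u → hamming u (flipAt p u) ≡ 1
hamming-flipAt zero    (b ∷ u) = begin
  hamming (b ∷ u) (not b ∷ u)  ≡⟨ hamming-comm (b ∷ u) (not b ∷ u) ⟩
  hamming (not b ∷ u) (b ∷ u)  ≡⟨ hamming-not∷ b u u ⟩
  suc (hamming u u)            ≡⟨ cong suc (hamming-refl u) ⟩
  1                            ∎
  where open ≡-Reasoning
hamming-flipAt (suc p) (b ∷ u) = trans (hamming-∷ b u (flipAt p u)) (hamming-flipAt p u)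

adjacent⇒flipAt : ∀ {n} (u v : Word n) → Adjacent u v → ∃ λ p → v ≡ flipAt p u
adjacent⇒flipAt []          []          ()
adjacent⇒flipAt (true ∷ u)  (true ∷ v)  d with adjacent⇒flipAt u v d
... | p , refl = suc p , refl
adjacent⇒flipAt (false ∷ u) (false ∷ v) d with adjacent⇒flipAt u v d
... | p , refl = suc p , refl
adjacent⇒flipAt (true ∷ u)  (false ∷ v) d = zero , cong (false ∷_) (sym (hamming≡0⇒≡ u v (suc-injective d)))
adjacent⇒flipAt (false ∷ u) (true ∷ v)  d = zero , cong (true ∷_) (sym (hamming≡0⇒≡ u v (suc-injective d)))

hamming-flipAt-flipAt : ∀ {n} (p q : Fin n) u → p ≢ q → hamming (flipAt p u) (flipAt q u) ≡ 2
hamming-flipAt-flipAt zero    zero    u       p≢q = contradiction refl p≢q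
hamming-flipAt-flipAt zero    (suc q) (b ∷ u) _   =
  trans (hamming-not∷ b u (flipAt q u)) (cong suc (hamming-flipAt q u))
hamming-flipAt-flipAt (suc p) zero    (b ∷ u) _   = begin
  hamming (b ∷ flipAt p u) (not b ∷ u)  ≡⟨ hamming-comm (b ∷ flipAt p u) (not b ∷ u) ⟩
  hamming (not b ∷ u) (b ∷ flipAt p u)  ≡⟨ hamming-not∷ b u (flipAt p u) ⟩
  suc (hamming u (flipAt p u))          ≡⟨ cong suc (hamming-flipAt p u) ⟩
  2                                     ∎
  where open ≡-Reasoning
hamming-flipAt-flipAt (suc p) (suc q) (b ∷ u) p≢q =
  trans (hamming-∷ b (flipAt p u) (flipAt q u)) (hamming-flipAt-flipAt p q u (p≢q ∘ cong suc))

flipAt∉N[flipAt] : ∀ {n} (p q : Fin n) u → p ≢ q → ¬ InN[ flipAt p u ] (flipAt q u)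
flipAt∉N[flipAt] p q u p≢q (inj₁ eq) = p≢q (sym (flipAt-injective q p u eq))
flipAt∉N[flipAt] p q u p≢q (inj₂ d) with () ← trans (sym (hamming-flipAt-flipAt p q u p≢q)) d

syndrome : ∀ {s n} → Vec (Word s) n → Word n → Word s
syndrome {s} []      []      = zeros s
syndrome     (h ∷ H) (b ∷ u) = if b then h ⊕ syndrome H u else syndrome H u

syndrome-flipAt : ∀ {s n} (H : Vec (Word s) n) p u →
  syndrome H (flipAt p u) ≡ syndrome H u ⊕ lookup H p
syndrome-flipAt (h ∷ H) zero    (true ∷ u)  = sym (trans (cong (_⊕ h) (⊕-comm h _)) (⊕-cancelʳ _ h))
syndrome-flipAt (h ∷ H) zero    (false ∷ u) = ⊕-comm h _
syndrome-flipAt (h ∷ H) (suc p) (true ∷ u)  =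
  trans (cong (h ⊕_) (syndrome-flipAt H p u)) (sym (⊕-assoc h _ _))
syndrome-flipAt (h ∷ H) (suc p) (false ∷ u) = syndrome-flipAt H p u

syndrome-++ : ∀ {s m n} (G : Vec (Word s) m) (H : Vec (Word s) n) v u →
  syndrome (G V.++ H) (v V.++ u) ≡ syndrome G v ⊕ syndrome H u
syndrome-++ []      H []          u = sym (⊕-identityˡ _)
syndrome-++ (g ∷ G) H (true ∷ v)  u = trans (cong (g ⊕_) (syndrome-++ G H v u)) (sym (⊕-assoc g _ _))
syndrome-++ (g ∷ G) H (false ∷ v) u = syndrome-++ G H v u

module KernelCode
  {s n} (H : Vec (Word s) n) (C : List (Word n))
  (kernel⊆C : ∀ c → syndrome H c ≡ zeros s → c ∈ C)
  (columns-onto : ∀ t → t VecMem.∈ H)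
  (zero₁ zero₂ : zeros s VecMem.∈ H) (zero₁≢zero₂ : VecAny.index zero₁ ≢ VecAny.index zero₂)
  where

  flipAt-kernel : ∀ u q → lookup H q ≡ syndrome H u → syndrome H (flipAt q u) ≡ zeros s
  flipAt-kernel u q Hq≡Hu = begin
    syndrome H (flipAt q u)          ≡⟨ syndrome-flipAt H q u ⟩
    syndrome H u ⊕ lookup H q        ≡⟨ cong (syndrome H u ⊕_) Hq≡Hu ⟩
    syndrome H u ⊕ syndrome H u      ≡⟨ ⊕-self (syndrome H u) ⟩
    zeros s                          ∎
    where open ≡-Reasoning

  column-matching : ∀ u → ∃ λ q → lookup H q ≡ syndrome H u
  column-matching u = VecAny.index t∈H , sym (lookup-index t∈H)
    where
    t∈H : syndrome H u VecMem.∈ H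
    t∈H = columns-onto (syndrome H u)

  zero-column-avoiding : ∀ p → ∃ λ q → p ≢ q × lookup H q ≡ zeros s
  zero-column-avoiding p with p Fin.≟ VecAny.index zero₁
  ... | yes refl = VecAny.index zero₂ , zero₁≢zero₂ , sym (lookup-index zero₂)
  ... | no p≢i   = VecAny.index zero₁ , p≢i , sym (lookup-index zero₁)

  separated-by-neighbour : ∀ u p q → p ≢ q → flipAt q u ∈ C → ¬ SameI C u (flipAt p u)
  separated-by-neighbour u p q p≢q c∈C same =
    flipAt∉N[flipAt] p q u p≢q (proj₂ (Equivalence.to (same (flipAt q u)) (c∈C , inj₂ (hamming-flipAt q u))))

  codeword-separated : ∀ u p → syndrome H u ≡ zeros s → ¬ SameI C u (flipAt p u)
  codeword-separated u p Hu≡0 with zero-column-avoiding p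
  ... | q , p≢q , Hq≡0 = separated-by-neighbour u p q p≢q
        (kernel⊆C (flipAt q u) (flipAt-kernel u q (trans Hq≡0 (sym Hu≡0))))

  flipAt-separated : ∀ u p → ¬ SameI C u (flipAt p u)
  flipAt-separated u p with column-matching u
  ... | q , Hq≡Hu with p Fin.≟ q
  ... | no p≢q  = separated-by-neighbour u p q p≢q (kernel⊆C (flipAt q u) (flipAt-kernel u q Hq≡Hu))
  ... | yes refl = λ same → codeword-separated (flipAt p u) p (flipAt-kernel u p Hq≡Hu)
        (subst (SameI C (flipAt p u)) (sym (flipAt-involutive p u)) (λ c → ⇔.sym (same c)))

  covering : IsCovering C
  covering u with column-matching u
  ... | q , Hq≡Hu = flipAt q u , kernel⊆C (flipAt q u) (flipAt-kernel u q Hq≡Hu) , inj₂ (hamming-flipAt q u)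

  isLocalIdentifying : IsLocalIdentifying C
  isLocalIdentifying = covering , λ u v u~v → case adjacent⇒flipAt u v u~v of λ where
    (p , refl) → flipAt-separated u p

unitColumns : ∀ s → Vec (Word s) s
unitColumns zero    = []
unitColumns (suc s) = (true ∷ zeros s) ∷ V.map (false ∷_) (unitColumns s)

syndrome-map-false∷ : ∀ {s n} (H : Vec (Word s) n) u →
  syndrome (V.map (false ∷_) H) u ≡ false ∷ syndrome H u
syndrome-map-false∷ []      []          = refl
syndrome-map-false∷ (h ∷ H) (true ∷ u)  = cong ((false ∷ h) ⊕_) (syndrome-map-false∷ H u)
syndrome-map-false∷ (h ∷ H) (false ∷ u) = syndrome-map-false∷ H u

syndrome-unitColumns : ∀ s (u : Word s) → syndrome (unitColumns s) u ≡ u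
syndrome-unitColumns zero    []      = refl
syndrome-unitColumns (suc s) (b ∷ u)
  rewrite syndrome-map-false∷ (unitColumns s) u | syndrome-unitColumns s u with b
... | true  = cong (true ∷_) (⊕-identityˡ u)
... | false = refl

allWords : ∀ n → List (Word n)
allWords zero    = [ [] ]
allWords (suc n) = map (false ∷_) (allWords n) ++ map (true ∷_) (allWords n)

length-map-∷-++ : ∀ {n} (xs ys : List (Word n)) →
  length (map (false ∷_) xs ++ map (true ∷_) ys) ≡ length xs + length ys
length-map-∷-++ xs ys =
  trans (length-++ (map (false ∷_) xs)) (cong₂ _+_ (length-map (false ∷_) xs) (length-map (true ∷_) ys))

∈-allWords : ∀ {n} (v : Word n) → v ∈ allWords n
∈-allWords []                = here refl
∈-allWords {suc n} (false ∷ v) = ∈-++⁺ˡ (∈-map⁺ (false ∷_) (∈-allWords v))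
∈-allWords {suc n} (true ∷ v)  = ∈-++⁺ʳ (map (false ∷_) (allWords n)) (∈-map⁺ (true ∷_) (∈-allWords v))

length-allWords : ∀ n → length (allWords n) ≡ 2 ^ n
length-allWords zero    = refl
length-allWords (suc n) = begin
  length (allWords (suc n))                ≡⟨ length-map-∷-++ (allWords n) (allWords n) ⟩
  length (allWords n) + length (allWords n) ≡⟨ cong₂ _+_ (length-allWords n) (length-allWords n) ⟩
  2 ^ n + 2 ^ n                            ≡⟨ cong (2 ^ n +_) (+-identityʳ (2 ^ n)) ⟨
  2 ^ suc n                                ∎
  where open ≡-Reasoning

allWords-unique : ∀ n → Unique (allWords n)
allWords-unique zero    = All.[] AllPairs.∷ AllPairs.[]
allWords-unique (suc n) =
  Unique.++⁺ (Unique.map⁺ ∷-injectiveʳ (allWords-unique n)) (Unique.map⁺ ∷-injectiveʳ (allWords-unique n))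
    λ (v∈F , v∈T) → case ∈-map⁻ (false ∷_) v∈F , ∈-map⁻ (true ∷_) v∈T of λ where
      ((_ , _ , refl) , (_ , _ , ()))

systematicCode : ∀ {s m} → Vec (Word s) m → List (Word (m + s))
systematicCode {m = m} R = map (λ v → v V.++ syndrome R v) (allWords m)

systematicCode-unique : ∀ {s m} (R : Vec (Word s) m) → Unique (systematicCode R)
systematicCode-unique {m = m} R = Unique.map⁺ (λ {v} {w} → ++-injectiveˡ v w) (allWords-unique m)

length-systematicCode : ∀ {s m} (R : Vec (Word s) m) → length (systematicCode R) ≡ 2 ^ m
length-systematicCode {m = m} R = trans (length-map _ (allWords m)) (length-allWords m)

kernel⊆systematicCode : ∀ {s m} (R : Vec (Word s) m) c →
  syndrome (R V.++ unitColumns s) c ≡ zeros s → c ∈ systematicCode R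
kernel⊆systematicCode {s} {m} R c Hc≡0 with V.splitAt m c
... | v , u , refl = subst (_∈ systematicCode R) (cong (v V.++_) (⊕≡zeros⇒≡ (syndrome R v) u Rv⊕u≡0))
                       (∈-map⁺ _ (∈-allWords v))
  where
  Rv⊕u≡0 : syndrome R v ⊕ u ≡ zeros s
  Rv⊕u≡0 = begin
    syndrome R v ⊕ u                            ≡⟨ cong (syndrome R v ⊕_) (syndrome-unitColumns s u) ⟨
    syndrome R v ⊕ syndrome (unitColumns s) u   ≡⟨ syndrome-++ R (unitColumns s) v u ⟨
    syndrome (R V.++ unitColumns s) (v V.++ u)  ≡⟨ Hc≡0 ⟩
    zeros s                                     ∎
    where open ≡-Reasoning

nonzeroWords : ∀ s → List (Word s)
nonzeroWords zero    = List.[]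
nonzeroWords (suc s) = map (false ∷_) (nonzeroWords s) ++ map (true ∷_) (allWords s)

nonUnitWords : ∀ s → List (Word s)
nonUnitWords zero    = [ [] ]
nonUnitWords (suc s) = map (false ∷_) (nonUnitWords s) ++ map (true ∷_) (nonzeroWords s)

zeros⊎∈nonzeroWords : ∀ {s} (t : Word s) → t ≡ zeros s ⊎ t ∈ nonzeroWords s
zeros⊎∈nonzeroWords []          = inj₁ refl
zeros⊎∈nonzeroWords {suc s} (true ∷ t) =
  inj₂ (∈-++⁺ʳ (map (false ∷_) (nonzeroWords s)) (∈-map⁺ (true ∷_) (∈-allWords t)))
zeros⊎∈nonzeroWords (false ∷ t) with zeros⊎∈nonzeroWords t
... | inj₁ refl = inj₁ refl
... | inj₂ t∈   = inj₂ (∈-++⁺ˡ (∈-map⁺ (false ∷_) t∈))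

∈unitColumns⊎∈nonUnitWords : ∀ {s} (t : Word s) → t VecMem.∈ unitColumns s ⊎ t ∈ nonUnitWords s
∈unitColumns⊎∈nonUnitWords []          = inj₂ (here refl)
∈unitColumns⊎∈nonUnitWords {suc s} (true ∷ t) with zeros⊎∈nonzeroWords t
... | inj₁ refl = inj₁ (here refl)
... | inj₂ t∈   = inj₂ (∈-++⁺ʳ (map (false ∷_) (nonUnitWords s)) (∈-map⁺ (true ∷_) t∈))
∈unitColumns⊎∈nonUnitWords (false ∷ t) with ∈unitColumns⊎∈nonUnitWords t
... | inj₁ t∈ = inj₁ (there (VecMem.∈-map⁺ (false ∷_) t∈))
... | inj₂ t∈ = inj₂ (∈-++⁺ˡ (∈-map⁺ (false ∷_) t∈))

zeros∈nonUnitWords : ∀ s → zeros s ∈ nonUnitWords s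
zeros∈nonUnitWords zero    = here refl
zeros∈nonUnitWords (suc s) = ∈-++⁺ˡ (∈-map⁺ (false ∷_) (zeros∈nonUnitWords s))

length-nonzeroWords : ∀ s → length (nonzeroWords s) + 1 ≡ 2 ^ s
length-nonzeroWords zero    = refl
length-nonzeroWords (suc s) = begin
  length (nonzeroWords (suc s)) + 1                         ≡⟨ cong (_+ 1) (length-map-∷-++ nz (allWords s)) ⟩
  length nz + length (allWords s) + 1                       ≡⟨ rearrange (length nz) (length (allWords s)) ⟩
  (length nz + 1) + (length (allWords s) + 0)               ≡⟨ cong₂ _+_ (length-nonzeroWords s) (cong (_+ 0) (length-allWords s)) ⟩
  2 ^ s + (2 ^ s + 0)                                       ∎
  where
  open ≡-Reasoning
  nz : List (Word s)
  nz = nonzeroWords s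
  rearrange : ∀ a b → a + b + 1 ≡ (a + 1) + (b + 0)
  rearrange = solve-∀

length-nonUnitWords : ∀ s → length (nonUnitWords s) + s ≡ 2 ^ s
length-nonUnitWords zero    = refl
length-nonUnitWords (suc s) = begin
  length (nonUnitWords (suc s)) + suc s                     ≡⟨ cong (_+ suc s) (length-map-∷-++ nu (nonzeroWords s)) ⟩
  length nu + length (nonzeroWords s) + suc s               ≡⟨ rearrange (length nu) (length (nonzeroWords s)) s ⟩
  (length nu + s) + ((length (nonzeroWords s) + 1) + 0)     ≡⟨ cong₂ _+_ (length-nonUnitWords s) (cong (_+ 0) (length-nonzeroWords s)) ⟩
  2 ^ s + (2 ^ s + 0)                                       ∎
  where
  open ≡-Reasoning
  nu : List (Word s)
  nu = nonUnitWords s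
  rearrange : ∀ a b s → a + b + suc s ≡ (a + s) + ((b + 1) + 0)
  rearrange = solve-∀

checkColumns : ∀ s k → Vec (Word s) (suc k + length (nonUnitWords s))
checkColumns s k = V.replicate (suc k) (zeros s) V.++ V.fromList (nonUnitWords s)

checkColumns-isLocalIdentifying : ∀ s k → IsLocalIdentifying (systematicCode (checkColumns s k))
checkColumns-isLocalIdentifying s k = KernelCode.isLocalIdentifying H (systematicCode R)
  (kernel⊆systematicCode R) columns-onto (here refl) zero₂ λ ()
  where
  R : Vec (Word s) (suc k + length (nonUnitWords s))
  R = checkColumns s k
  H : Vec (Word s) (suc k + length (nonUnitWords s) + s)
  H = R V.++ unitColumns s

  columns-onto : ∀ t → t VecMem.∈ H
  columns-onto t with ∈unitColumns⊎∈nonUnitWords t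
  ... | inj₁ t∈ = VecMem.∈-++⁺ʳ R t∈
  ... | inj₂ t∈ = VecMem.∈-++⁺ˡ (VecMem.∈-++⁺ʳ (V.replicate (suc k) (zeros s)) (VecMem.∈-fromList⁺ t∈))

  zero₂ : zeros s VecMem.∈ H
  zero₂ = there (VecMem.∈-++⁺ˡ (VecMem.∈-++⁺ʳ (V.replicate k (zeros s))
            (VecMem.∈-fromList⁺ (zeros∈nonUnitWords s))))

dimensions : ∀ {t} ν s k → ν + s ≡ t →
  suc k + ν + s ≡ t + suc (suc k) ∸ 1 × suc k + ν ≡ t + suc (suc k) ∸ s ∸ 1
dimensions ν s k refl =
  cong (_∸ 1) (rearrange₁ ν s k) ,
  cong (_∸ 1) (trans (sym (m+n∸m≡n s (suc (suc k + ν)))) (cong (_∸ s) (rearrange₂ ν s k)))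
  where
  rearrange₁ : ∀ ν s k → suc (suc k + ν + s) ≡ ν + s + suc (suc k)
  rearrange₁ = solve-∀
  rearrange₂ : ∀ ν s k → s + suc (suc k + ν) ≡ ν + s + suc (suc k)
  rearrange₂ = solve-∀

mainTheorem2 : (s k : ℕ) → 2 ≤ s → 2 ≤ k →
    Σ (List (Word (2 ^ s + k ∸ 1))) λ C →
      Unique C × IsLocalIdentifying C × length C ≤ 2 ^ (2 ^ s + k ∸ s ∸ 1)
mainTheorem2 s (suc (suc k)) _ (s≤s (s≤s _))
  with dimensions (length (nonUnitWords s)) s k (length-nonUnitWords s)
... | n≡ , m≡ = subst₂ Bounded n≡ m≡
  (systematicCode R , systematicCode-unique R , checkColumns-isLocalIdentifying s k ,
   ≤-reflexive (length-systematicCode R))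
  where
  R : Vec (Word s) (suc k + length (nonUnitWords s))
  R = checkColumns s k
  Bounded : ℕ → ℕ → Set
  Bounded n m = Σ (List (Word n)) λ C → Unique C × IsLocalIdentifying C × length C ≤ 2 ^ m
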